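{- Let $q$ be a prime power and $n,m\ge0$ integers. Let $R_q(n,m,r)$ be the number of $n\times m$ matrices of rank $r$ over $\mathbb{F}_q$ (with the empty matrix of rank $0$). Let $a$ be an integer with $a\ge n+m$. Then $$\sum_{r\ge0}R_q(n,m,r)\,(q;q)_{a-r}=q^{nm}\frac{(q;q)_{a-n}(q;q)_{a-m}}{(q;q)_{a-n-m}}.$$
   Context: $(x;q)_r=\prod_{i=0}^{r-1}(1-xq^i)$ denotes the $q$-Pochhammer symbol. -}

module Defs where

open import Level using (0ℓ)
open import Data.Nat as ℕ using (ℕ; zero; suc; _∸_)
open import Data.Integer as ℤ using (ℤ; +_)
open import Data.Fin using (Fin; zero; suc)
open import Data.Bool using (Bool; true; false; _∧_; not; if_then_else_)
open import Data.List as List using (List; []; _∷_; map; concatMap; length; filter; foldr)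
open import Data.Vec as Vec using (Vec; []; _∷_)
open import Data.Product using (Σ; ∃; _,_)
open import Function.Bundles using (_↔_; Inverse)
open import Relation.Binary.PropositionalEquality using (_≡_; _≢_)
open import Relation.Binary.Definitions using (DecidableEquality)
open import Relation.Nullary.Decidable using (⌊_⌋)
open import Algebra.Structures using (IsCommutativeRing)

-- A finite field with exactly q elements (so q is necessarily a prime
-- power, and the field is (isomorphic to) F_q).

record FiniteField (q : ℕ) : Set₁ where
  infixl 6 _+_
  infixl 7 _*_
  field
    Carrier   : Set
    _≟_       : DecidableEquality Carrier
    _+_ _*_   : Carrier → Carrier → Carrier
    -_        : Carrier → Carrier
    0# 1#     : Carrier
    isCommutativeRing : IsCommutativeRing _≡_ _+_ _*_ -_ 0# 1#
    0≢1       : 0# ≢ 1#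
    inverse   : ∀ x → x ≢ 0# → ∃ λ y → x * y ≡ 1#
    enumeration : Fin q ↔ Carrier

module _ {q : ℕ} (F : FiniteField q) where
  open FiniteField F

  elements : List Carrier
  elements = List.map (Inverse.to enumeration) (List.allFin q)

  allVecs : (k : ℕ) → List (Fin k → Carrier)
  allVecs zero    = (λ ()) ∷ []
  allVecs (suc k) =
    concatMap (λ x → List.map (λ v → λ { zero → x ; (suc i) → v i }) (allVecs k)) elements

  -- n × m matrices over F (row i, column j)
  Matrix : ℕ → ℕ → Set
  Matrix n m = Fin n → Fin m → Carrier

  allMatrices : (n m : ℕ) → List (Matrix n m)
  allMatrices zero    m = (λ ()) ∷ []
  allMatrices (suc n) m =
    concatMap (λ r → List.map (λ A → λ { zero → r ; (suc i) → A i }) (allMatrices n m)) (allVecs m)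

  allSubsets : (n : ℕ) → List (Vec Bool n)
  allSubsets zero    = [] ∷ []
  allSubsets (suc n) = concatMap (λ s → (true ∷ s) ∷ (false ∷ s) ∷ []) (allSubsets n)

  isZero : Carrier → Bool
  isZero x = ⌊ x ≟ 0# ⌋

  Fsum : (n : ℕ) → (Fin n → Carrier) → Carrier
  Fsum zero    f = 0#
  Fsum (suc n) f = f zero + Fsum n (λ i → f (suc i))

  allL : {A : Set} → (A → Bool) → List A → Bool
  allL p []       = true
  allL p (x ∷ xs) = p x ∧ allL p xs

  allFin? : (n : ℕ) → (Fin n → Bool) → Bool
  allFin? n p = allL p (List.allFin n)

  -- The rows of A indexed by S are linearly independent:
  -- every coefficient vector c supported on S with Σ_i c_i A_i = 0 is zero.
  independentRows : {n m : ℕ} → Matrix n m → Vec Bool n → Bool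
  independentRows {n} {m} A S =
    allL (λ c → not (allFin? n (λ i → if Vec.lookup S i then true else isZero (c i))
                   ∧ allFin? m (λ j → isZero (Fsum n (λ i → c i * A i j))))
               ∨' allFin? n (λ i → isZero (c i)))
        (allVecs n)
    where
      _∨'_ : Bool → Bool → Bool
      true  ∨' _ = true
      false ∨' b = b

  size : {n : ℕ} → Vec Bool n → ℕ
  size []            = 0
  size (true  ∷ s)   = suc (size s)
  size (false ∷ s)   = size s

  -- rank = maximal number of linearly independent rows
  -- (the empty matrix has rank 0)
  rank : {n m : ℕ} → Matrix n m → ℕ
  rank {n} A = foldr ℕ._⊔_ 0
    (List.map size (filter (λ S → Data.Bool._≟_ (independentRows A S) true) (allSubsets n)))
    where import Data.Bool

  R : (n m r : ℕ) → ℕ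
  R n m r = length (filter (λ A → rank A ℕ.≟ r) (allMatrices n m))

poch : ℤ → ℤ → ℕ → ℤ
poch x q zero    = ℤ.+ 1
poch x q (suc r) = poch x q r ℤ.* (ℤ.+ 1 ℤ.- x ℤ.* (q ℤ.^ r))

sumTo : ℕ → (ℕ → ℤ) → ℤ
sumTo zero    f = f 0
sumTo (suc a) f = sumTo a f ℤ.+ f (suc a)

-- Appending a row v to a matrix A raises the rank by one exactly when v lies outside the row
-- space of A, and that row space has q ^ rank A elements: a basis is built row by row, and each
-- independent row multiplies the size of the span by q, since every vector of the span has a
-- unique coefficient on it.  Hence R(n+1,m,r) = R(n,m,r) q^r + R(n,m,r-1) (q^m - q^(r-1)).
-- With (q;q)_(k+1) = (q;q)_k (1 - q^(k+1)) this recurrence turns Φ n a = Σ_r R(n,m,r) (q;q)_(a-r)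
-- into Φ (n+1) (a+1) = (q^m - q^(a+1)) Φ n a, and induction on n gives the product formula.

module Submission where

open import Defs
open import Level using (0ℓ)
open import Algebra.Bundles using (CommutativeRing)
open import Data.Bool using (Bool; true; false; not; if_then_else_)
import Data.Bool.Properties as Boolₚ
open import Data.Empty using (⊥-elim)
open import Data.Fin using (Fin; zero; suc)
import Data.Fin.Properties as Finₚ
open import Data.List as List using (List; []; _∷_; _++_; map; concatMap; length; filter; foldr; allFin)
open import Data.List.Membership.Propositional using (_∈_)
open import Data.List.Membership.Propositional.Properties
  using (∈-allFin; ∈-map⁺; ∈-map⁻; ∈-filter⁺; ∈-filter⁻; foldr-selective)
open import Data.List.Properties using (length-map; length-tabulate)
open import Data.List.Relation.Unary.All as All using (All; []; _∷_)
open import Data.List.Relation.Unary.AllPairs using ([]; _∷_)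
open import Data.List.Relation.Unary.Any as Any using (Any; here; there; any?)
import Data.List.Relation.Unary.Any.Properties as Anyₚ
open import Data.List.Relation.Unary.Unique.Propositional using (Unique)
import Data.List.Relation.Unary.Unique.Propositional.Properties as Uniqueₚ
open import Data.Nat as ℕ using (ℕ; zero; suc; _≤_; _<_; z≤n; s≤s)
import Data.Nat.Properties as ℕₚ
open import Data.Product using (∃; _×_; _,_; proj₁; proj₂)
open import Data.Sum using (inj₁; inj₂)
open import Data.Vec using (Vec; []; _∷_; lookup; replicate)
open import Data.Vec.Properties using (lookup-replicate)
open import Data.Vec.Functional using (Vector; head; tail) renaming (_∷_ to _∷ᵛ_)
open import Function using (_∘_; _∘′_; _⇔_; mk⇔; Equivalence; Injection; Inverse)
open import Function.Properties.Inverse using (Inverse⇒Injection)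
open import Relation.Binary.Definitions using (DecidableEquality)
open import Relation.Binary.PropositionalEquality
open import Relation.Nullary using (Dec; yes; no; does; ¬_)
open import Relation.Nullary.Decidable using (map′; _×-dec_; _→-dec_; dec-true; dec-false)

module ListCounting where

  open import Data.Nat using (_+_; _*_; _⊔_; _≟_; _≡ᵇ_)
  open import Data.Nat.Properties
  open import Algebra.Properties.CommutativeSemigroup +-commutativeSemigroup using (interchange)

  private
    variable
      A B : Set

  false≢true : false ≢ true
  false≢true ()

  𝟙 : Bool → ℕ
  𝟙 true  = 1
  𝟙 false = 0

  sumBy : (A → ℕ) → List A → ℕ
  sumBy f []       = 0
  sumBy f (x ∷ xs) = f x + sumBy f xs

  syntax sumBy (λ x → e) xs = ∑[ x ∈ xs ] e

  count : (A → Bool) → List A → ℕ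
  count p xs = ∑[ x ∈ xs ] 𝟙 (p x)

  sumBy-cong : {f g : A → ℕ} → f ≗ g → (xs : List A) → sumBy f xs ≡ sumBy g xs
  sumBy-cong f≗g []       = refl
  sumBy-cong f≗g (x ∷ xs) = cong₂ _+_ (f≗g x) (sumBy-cong f≗g xs)

  sumBy-mono : {f g : A → ℕ} → (∀ x → f x ≤ g x) → (xs : List A) → sumBy f xs ≤ sumBy g xs
  sumBy-mono f≤g []       = ≤-refl
  sumBy-mono f≤g (x ∷ xs) = +-mono-≤ (f≤g x) (sumBy-mono f≤g xs)

  sumBy-++ : (f : A → ℕ) (xs ys : List A) → sumBy f (xs ++ ys) ≡ sumBy f xs + sumBy f ys
  sumBy-++ f []       ys = refl
  sumBy-++ f (x ∷ xs) ys = trans (cong (f x +_) (sumBy-++ f xs ys)) (sym (+-assoc (f x) _ _))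

  sumBy-map : (f : A → ℕ) (g : B → A) (xs : List B) → sumBy f (map g xs) ≡ sumBy (f ∘ g) xs
  sumBy-map f g []       = refl
  sumBy-map f g (x ∷ xs) = cong (f (g x) +_) (sumBy-map f g xs)

  sumBy-concatMap : (f : A → ℕ) (g : B → List A) (xs : List B) →
    sumBy f (concatMap g xs) ≡ ∑[ x ∈ xs ] sumBy f (g x)
  sumBy-concatMap f g []       = refl
  sumBy-concatMap f g (x ∷ xs) =
    trans (sumBy-++ f (g x) (concatMap g xs)) (cong (sumBy f (g x) +_) (sumBy-concatMap f g xs))

  sumBy-+ : (f g : A → ℕ) (xs : List A) → ∑[ x ∈ xs ] (f x + g x) ≡ sumBy f xs + sumBy g xs
  sumBy-+ f g []       = refl
  sumBy-+ f g (x ∷ xs) = trans (cong (f x + g x +_) (sumBy-+ f g xs)) (interchange (f x) (g x) _ _)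

  sumBy-*ˡ : (c : ℕ) (f : A → ℕ) (xs : List A) → ∑[ x ∈ xs ] (c * f x) ≡ c * sumBy f xs
  sumBy-*ˡ c f []       = sym (*-zeroʳ c)
  sumBy-*ˡ c f (x ∷ xs) = trans (cong (c * f x +_) (sumBy-*ˡ c f xs)) (sym (*-distribˡ-+ c (f x) _))

  sumBy-*ʳ : (c : ℕ) (f : A → ℕ) (xs : List A) → ∑[ x ∈ xs ] (f x * c) ≡ sumBy f xs * c
  sumBy-*ʳ c f []       = refl
  sumBy-*ʳ c f (x ∷ xs) = trans (cong (f x * c +_) (sumBy-*ʳ c f xs)) (sym (*-distribʳ-+ c (f x) _))

  sumBy-const : (c : ℕ) (xs : List A) → ∑[ x ∈ xs ] c ≡ length xs * c
  sumBy-const c []       = refl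
  sumBy-const c (x ∷ xs) = cong (c +_) (sumBy-const c xs)

  sumBy-vanishing : {f : A → ℕ} {xs : List A} → All (λ x → f x ≡ 0) xs → sumBy f xs ≡ 0
  sumBy-vanishing []            = refl
  sumBy-vanishing (fx≡0 ∷ f≡0) = cong₂ _+_ fx≡0 (sumBy-vanishing f≡0)

  sumBy-zero : {f : A → ℕ} → (∀ x → f x ≡ 0) → (xs : List A) → sumBy f xs ≡ 0
  sumBy-zero f≡0 xs = sumBy-vanishing {xs = xs} (All.tabulate (λ {x} _ → f≡0 x))

  sumBy-comm : (f : A → B → ℕ) (xs : List A) (ys : List B) →
    ∑[ x ∈ xs ] ∑[ y ∈ ys ] f x y ≡ ∑[ y ∈ ys ] ∑[ x ∈ xs ] f x y
  sumBy-comm f []       ys = sym (sumBy-zero (λ _ → refl) ys)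
  sumBy-comm f (x ∷ xs) ys =
    trans (cong (sumBy (f x) ys +_) (sumBy-comm f xs ys)) (sym (sumBy-+ (f x) _ ys))

  count-true : (xs : List A) → count (λ _ → true) xs ≡ length xs
  count-true xs = trans (sumBy-const 1 xs) (*-identityʳ (length xs))

  count+count-not : (p : A → Bool) (xs : List A) → count p xs + count (not ∘ p) xs ≡ length xs
  count+count-not p []       = refl
  count+count-not p (x ∷ xs) with p x
  ... | true  = cong suc (count+count-not p xs)
  ... | false = trans (+-suc _ _) (cong suc (count+count-not p xs))

  length-filter≡count : {P : A → Set} (P? : ∀ x → Dec (P x)) (xs : List A) →
    length (filter P? xs) ≡ count (does ∘ P?) xs
  length-filter≡count P? []       = refl
  length-filter≡count P? (x ∷ xs) with P? x
  ... | yes _ = cong suc (length-filter≡count P? xs)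
  ... | no  _ = length-filter≡count P? xs

  𝟙≡count : {p : A → Bool} {xs : List A} → Unique xs → (∀ x y → p x ≡ true → p y ≡ true → x ≡ y) →
    {b : Bool} → b ≡ true ⇔ Any (λ x → p x ≡ true) xs → 𝟙 b ≡ count p xs
  𝟙≡count {xs = []} _ _ {false} _  = refl
  𝟙≡count {xs = []} _ _ {true}  b⇔ with () ← Equivalence.to b⇔ refl
  𝟙≡count {p = p} {x ∷ xs} (x∉ ∷ uniq) p-one {b} b⇔ with p x in px
  ... | true  rewrite Equivalence.from b⇔ (here px) =
    sym (cong suc (sumBy-vanishing (All.map p≡false x∉)))
    where
    p≡false : ∀ {y} → ¬ x ≡ y → 𝟙 (p y) ≡ 0
    p≡false {y} x≢y with p y in py
    ... | true  = ⊥-elim (x≢y (p-one x y px py))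
    ... | false = refl
  ... | false =
    𝟙≡count uniq p-one (mk⇔ (skip ∘ Equivalence.to b⇔) (Equivalence.from b⇔ ∘ there))
    where
    skip : Any (λ y → p y ≡ true) (x ∷ xs) → Any (λ y → p y ≡ true) xs
    skip (here px′)  = ⊥-elim (false≢true (trans (sym px) px′))
    skip (there any) = any

  sumBy-indicator : (_≟_ : DecidableEquality A) (h : A → ℕ) {xs : List A} → Unique xs →
    {z : A} → z ∈ xs → ∑[ y ∈ xs ] (𝟙 (does (y ≟ z)) * h y) ≡ h z
  sumBy-indicator _≟_ h {x ∷ xs} (x∉ ∷ uniq) {z} z∈ with x ≟ z | z∈
  ... | yes refl | _         = trans (cong₂ _+_ (+-identityʳ (h x)) (sumBy-vanishing (All.map off x∉)))
                                     (+-identityʳ (h x))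
    where
    off : ∀ {y} → ¬ x ≡ y → 𝟙 (does (y ≟ x)) * h y ≡ 0
    off {y} x≢y with y ≟ x
    ... | yes y≡x = ⊥-elim (x≢y (sym y≡x))
    ... | no  _   = refl
  ... | no x≢z   | here z≡x  = ⊥-elim (x≢z (sym z≡x))
  ... | no _     | there z∈′ = sumBy-indicator _≟_ h uniq z∈′

  count-mono : {p p′ : A → Bool} → (∀ x → p x ≡ true → p′ x ≡ true) → (xs : List A) →
    count p xs ≤ count p′ xs
  count-mono {p = p} {p′} p⇒p′ = sumBy-mono 𝟙-mono
    where
    𝟙-mono : ∀ x → 𝟙 (p x) ≤ 𝟙 (p′ x)
    𝟙-mono x with p x in px
    ... | false = z≤n
    ... | true rewrite p⇒p′ x px = ≤-refl

  does-⇔ : {P Q : Set} (P? : Dec P) (Q? : Dec Q) → P ⇔ Q → does P? ≡ does Q?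
  does-⇔ (yes p) Q? P⇔Q = sym (dec-true Q? (Equivalence.to P⇔Q p))
  does-⇔ (no ¬p) Q? P⇔Q = sym (dec-false Q? (¬p ∘ Equivalence.from P⇔Q))

  does≡true⇔ : {P : Set} (P? : Dec P) → does P? ≡ true ⇔ P
  does≡true⇔ (yes p) = mk⇔ (λ _ → p) (λ _ → refl)
  does≡true⇔ (no ¬p) = mk⇔ (λ ()) (⊥-elim ∘ ¬p)

  All×Any⇒∃ : {P Q : A → Set} {xs : List A} → All P xs → Any Q xs → ∃ λ x → P x × Q x
  All×Any⇒∃ ps qs = Any.lookup qs , All.lookupAny ps qs

  ≤-foldr-⊔ : {k : ℕ} {ks : List ℕ} → k ∈ ks → k ≤ foldr _⊔_ 0 ks
  ≤-foldr-⊔ {ks = k ∷ ks} (here refl) = m≤m⊔n k _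
  ≤-foldr-⊔ {ks = k ∷ ks} (there k∈) = m≤n⇒m≤o⊔n k (≤-foldr-⊔ k∈)

  δ : ℕ → ℕ → ℕ
  δ k r = 𝟙 (does (k ≟ r))

  ≡ᵇ-refl : ∀ k → (k ≡ᵇ k) ≡ true
  ≡ᵇ-refl k = dec-true (k ≟ k) refl

  ≢⇒≡ᵇ-false : ∀ {k r} → ¬ k ≡ r → (k ≡ᵇ r) ≡ false
  ≢⇒≡ᵇ-false {k} {r} k≢r = dec-false (k ≟ r) k≢r

  δ-+𝟙 : ∀ k r b → δ (k + 𝟙 (not b)) r ≡ δ k r * 𝟙 b + δ (suc k) r * 𝟙 (not b)
  δ-+𝟙 k r true  = trans (cong (λ k′ → δ k′ r) (+-identityʳ k))
    (sym (trans (cong₂ _+_ (*-identityʳ (δ k r)) (*-zeroʳ (δ (suc k) r))) (+-identityʳ (δ k r))))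
  δ-+𝟙 k r false = trans (cong (λ k′ → δ k′ r) (+-comm k 1))
    (sym (cong₂ _+_ (*-zeroʳ (δ k r)) (*-identityʳ (δ (suc k) r))))

open ListCounting

module LinearAlgebra {q : ℕ} (F : FiniteField q) where

  open FiniteField F public using (Carrier; _≟_; _+_; _*_; -_; 0#; 1#; inverse)

  commutativeRing : CommutativeRing 0ℓ 0ℓ
  commutativeRing = record { isCommutativeRing = FiniteField.isCommutativeRing F }

  open CommutativeRing commutativeRing public
    using (_-_; +-comm; +-identityˡ; +-identityʳ; *-assoc; *-comm; *-identityˡ;
           distribˡ; distribʳ; zeroˡ; zeroʳ; -‿inverseʳ; +-commutativeSemigroup)
  open import Algebra.Properties.Ring (CommutativeRing.ring commutativeRing) public
    using (-1*x≈-x; -‿distribˡ-*; -‿distribʳ-*; -‿involutive; -0#≈0#; +-inverseʳ-unique;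
           //-rightDividesˡ; //-rightDividesʳ; x∙y⁻¹≈ε⇒x≈y)
  open import Algebra.Properties.CommutativeSemigroup +-commutativeSemigroup using (interchange)
  open ≡-Reasoning

  x+[y-x]≡y : ∀ x y → x + (y - x) ≡ y
  x+[y-x]≡y x y = trans (+-comm x (y - x)) (//-rightDividesˡ x y)

  x+y≡z⇒y≡z-x : ∀ {x y z} → x + y ≡ z → y ≡ z - x
  x+y≡z⇒y≡z-x {x} {y} x+y≡z =
    trans (sym (//-rightDividesʳ x y)) (cong (_- x) (trans (+-comm y x) x+y≡z))

  Fsum-cong : ∀ n {f g : Fin n → Carrier} → f ≗ g → Fsum F n f ≡ Fsum F n g
  Fsum-cong zero    f≗g = refl
  Fsum-cong (suc n) f≗g = cong₂ _+_ (f≗g zero) (Fsum-cong n (f≗g ∘ suc))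

  Fsum-+ : ∀ n (f g : Fin n → Carrier) → Fsum F n (λ i → f i + g i) ≡ Fsum F n f + Fsum F n g
  Fsum-+ zero    f g = sym (+-identityˡ 0#)
  Fsum-+ (suc n) f g =
    trans (cong (f zero + g zero +_) (Fsum-+ n (f ∘ suc) (g ∘ suc))) (interchange _ _ _ _)

  Fsum-*ˡ : ∀ n (t : Carrier) (f : Fin n → Carrier) → Fsum F n (λ i → t * f i) ≡ t * Fsum F n f
  Fsum-*ˡ zero    t f = sym (zeroʳ t)
  Fsum-*ˡ (suc n) t f = trans (cong (t * f zero +_) (Fsum-*ˡ n t (f ∘ suc))) (sym (distribˡ t _ _))

  0ᵛ : ∀ {m} → Vector Carrier m
  0ᵛ _ = 0#

  _-[_]·_ : ∀ {m} → Vector Carrier m → Carrier → Vector Carrier m → Vector Carrier m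
  (w -[ t ]· v) j = w j - t * v j

  -[0]·-identity : ∀ {m} (w v : Vector Carrier m) → w -[ 0# ]· v ≗ w
  -[0]·-identity w v j =
    trans (cong (λ x → w j + - x) (zeroˡ (v j))) (trans (cong (w j +_) -0#≈0#) (+-identityʳ (w j)))

  -- Definitionally the combination tested by independentRows.
  lincomb : ∀ {n m} → Vector Carrier n → Matrix F n m → Vector Carrier m
  lincomb {n} c B j = Fsum F n (λ i → c i * B i j)

  module _ {n m : ℕ} where

    lincomb-cong : {c d : Vector Carrier n} (B : Matrix F n m) → c ≗ d → lincomb c B ≗ lincomb d B
    lincomb-cong B c≗d j = Fsum-cong n (λ i → cong (_* B i j) (c≗d i))

    lincomb-+ : (c d : Vector Carrier n) (B : Matrix F n m) →
      lincomb (λ i → c i + d i) B ≗ λ j → lincomb c B j + lincomb d B j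
    lincomb-+ c d B j = trans (Fsum-cong n (λ i → distribʳ (B i j) (c i) (d i))) (Fsum-+ n _ _)

    lincomb-*ˡ : (t : Carrier) (c : Vector Carrier n) (B : Matrix F n m) →
      lincomb (λ i → t * c i) B ≗ λ j → t * lincomb c B j
    lincomb-*ˡ t c B j = trans (Fsum-cong n (λ i → *-assoc t (c i) (B i j))) (Fsum-*ˡ n t _)

  lincomb-head≡0 : ∀ {n m} (c : Vector Carrier (suc n)) (B : Matrix F (suc n) m) → head c ≡ 0# →
    lincomb c B ≗ lincomb (tail c) (tail B)
  lincomb-head≡0 c B c₀≡0 j =
    trans (cong (λ x → x * head B j + rest) c₀≡0) (trans (cong (_+ rest) (zeroˡ (head B j))) (+-identityˡ rest))
    where rest = lincomb (tail c) (tail B) j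

  lincomb-∷ : ∀ {n m} {t : Carrier} {c : Vector Carrier n} {w : Vector Carrier m} (B : Matrix F (suc n) m) →
    lincomb c (tail B) ≗ w -[ t ]· head B → lincomb (t ∷ᵛ c) B ≗ w
  lincomb-∷ {t = t} {w = w} B eq j = trans (cong (t * head B j +_) (eq j)) (x+[y-x]≡y (t * head B j) (w j))

  SupportedOn : ∀ {n} → Vec Bool n → Vector Carrier n → Set
  SupportedOn S c = ∀ i → lookup S i ≡ false → c i ≡ 0#

  record InSpan {n m} (B : Matrix F n m) (S : Vec Bool n) (w : Vector Carrier m) : Set where
    constructor spanned
    field
      coeffs    : Vector Carrier n
      supported : SupportedOn S coeffs
      combines  : lincomb coeffs B ≗ w

  Independent : ∀ {n m} → Matrix F n m → Vec Bool n → Set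
  Independent {n} B S = ∀ (c : Vector Carrier n) → SupportedOn S c → lincomb c B ≗ 0ᵛ → c ≗ 0ᵛ

  module _ {n m : ℕ} {B : Matrix F n m} {S : Vec Bool n} where

    inSpan-resp : {u w : Vector Carrier m} → u ≗ w → InSpan B S u → InSpan B S w
    inSpan-resp u≗w (spanned c supp eq) = spanned c supp λ j → trans (eq j) (u≗w j)

    inSpan-+ : {u w : Vector Carrier m} → InSpan B S u → InSpan B S w → InSpan B S (λ j → u j + w j)
    inSpan-+ (spanned c suppc eqc) (spanned d suppd eqd) = spanned
      (λ i → c i + d i)
      (λ i i∉S → trans (cong₂ _+_ (suppc i i∉S) (suppd i i∉S)) (+-identityˡ 0#))
      (λ j → trans (lincomb-+ c d B j) (cong₂ _+_ (eqc j) (eqd j)))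

    inSpan-*ˡ : {w : Vector Carrier m} (t : Carrier) → InSpan B S w → InSpan B S (λ j → t * w j)
    inSpan-*ˡ t (spanned c supp eq) = spanned
      (λ i → t * c i)
      (λ i i∉S → trans (cong (t *_) (supp i i∉S)) (zeroʳ t))
      (λ j → trans (lincomb-*ˡ t c B j) (cong (t *_) (eq j)))

    independent⇒lincomb-injective : Independent B S → {c d : Vector Carrier n} →
      SupportedOn S c → SupportedOn S d → lincomb c B ≗ lincomb d B → c ≗ d
    independent⇒lincomb-injective ind {c} {d} suppc suppd c≗d i =
      x∙y⁻¹≈ε⇒x≈y (c i) (d i)
        (trans (cong (c i +_) (sym (-1*x≈-x (d i)))) (ind diff supp-diff diff≗0 i))
      where
      diff : Vector Carrier n
      diff i = c i + - 1# * d i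
      supp-diff : SupportedOn S diff
      supp-diff i i∉S =
        trans (cong₂ (λ x y → x + - 1# * y) (suppc i i∉S) (suppd i i∉S))
              (trans (+-identityˡ _) (zeroʳ (- 1#)))
      diff≗0 : lincomb diff B ≗ 0ᵛ
      diff≗0 j = begin
        lincomb diff B j                                ≡⟨ lincomb-+ c _ B j ⟩
        lincomb c B j + lincomb (λ i → - 1# * d i) B j  ≡⟨ cong (lincomb c B j +_) (lincomb-*ˡ (- 1#) d B j) ⟩
        lincomb c B j + - 1# * lincomb d B j            ≡⟨ cong (λ x → x + - 1# * lincomb d B j) (c≗d j) ⟩
        lincomb d B j + - 1# * lincomb d B j            ≡⟨ cong (lincomb d B j +_) (-1*x≈-x _) ⟩
        lincomb d B j - lincomb d B j                   ≡⟨ -‿inverseʳ _ ⟩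
        0#                                              ∎

  module _ {n m : ℕ} (B : Matrix F (suc n) m) {S : Vec Bool n} where

    inSpan-∷⁻ : ∀ {b w} → InSpan B (b ∷ S) w →
      ∃ λ t → (b ≡ false → t ≡ 0#) × InSpan (tail B) S (w -[ t ]· head B)
    inSpan-∷⁻ (spanned c supp eq) =
      head c , supp zero , spanned (tail c) (supp ∘ suc) (λ j → x+y≡z⇒y≡z-x (eq j))

    inSpan-∷⁺ : ∀ {b w t} → (b ≡ false → t ≡ 0#) → InSpan (tail B) S (w -[ t ]· head B) →
      InSpan B (b ∷ S) w
    inSpan-∷⁺ {t = t} b⇒t≡0 (spanned c supp eq) =
      spanned (t ∷ᵛ c) (λ { zero → b⇒t≡0 ; (suc i) → supp i }) (lincomb-∷ B eq)

    inSpan-false∷⇒tail : ∀ {w} → InSpan B (false ∷ S) w → InSpan (tail B) S w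
    inSpan-false∷⇒tail (spanned c supp eq) =
      spanned (tail c) (supp ∘ suc) (λ j → trans (sym (lincomb-head≡0 c B (supp zero refl) j)) (eq j))

    inSpan-tail⇒false∷ : ∀ {w} → InSpan (tail B) S w → InSpan B (false ∷ S) w
    inSpan-tail⇒false∷ {w} w∈ =
      inSpan-∷⁺ (λ _ → refl) (inSpan-resp (λ j → sym (-[0]·-identity w (head B) j)) w∈)

    head-inSpan-tail : (e : Vector Carrier (suc n)) → lincomb e B ≗ 0ᵛ → ¬ head e ≡ 0# →
      SupportedOn S (tail e) → InSpan (tail B) S (head B)
    head-inSpan-tail e e≗0 e₀≢0 supp =
      inSpan-resp rescale (inSpan-*ˡ (- d) (spanned (tail e) supp λ j → refl))
      where
      d = proj₁ (inverse (head e) e₀≢0)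
      e₀d≡1 = proj₂ (inverse (head e) e₀≢0)
      rescale : ∀ j → - d * lincomb (tail e) (tail B) j ≡ head B j
      rescale j = begin
        - d * lincomb (tail e) (tail B) j  ≡⟨ cong (- d *_) (+-inverseʳ-unique _ _ (e≗0 j)) ⟩
        - d * - (head e * head B j)        ≡⟨ -‿distribˡ-* d _ ⟨
        - (d * - (head e * head B j))      ≡⟨ cong -_ (-‿distribʳ-* d _) ⟨
        - - (d * (head e * head B j))      ≡⟨ -‿involutive _ ⟩
        d * (head e * head B j)            ≡⟨ *-assoc d (head e) _ ⟨
        d * head e * head B j              ≡⟨ cong (_* head B j) (trans (*-comm d (head e)) e₀d≡1) ⟩
        1# * head B j                      ≡⟨ *-identityˡ _ ⟩
        head B j                           ∎

    independent-tail : ∀ {b} → Independent B (b ∷ S) → Independent (tail B) S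
    independent-tail ind c supp c≗0 i =
      ind (0# ∷ᵛ c) (λ { zero _ → refl ; (suc i) → supp i })
          (λ j → trans (lincomb-head≡0 (0# ∷ᵛ c) B refl j) (c≗0 j)) (suc i)

    independent-∷ : ∀ {b} → Independent (tail B) S → (b ≡ true → ¬ InSpan (tail B) S (head B)) →
      Independent B (b ∷ S)
    independent-∷ {b} ind head∉ c supp c≗0 with head c ≟ 0#
    ... | yes c₀≡0 = λ { zero → c₀≡0
                       ; (suc i) → ind (tail c) (supp ∘ suc)
                                       (λ j → trans (sym (lincomb-head≡0 c B c₀≡0 j)) (c≗0 j)) i }
    ... | no c₀≢0 with b
    ...   | true  = ⊥-elim (head∉ refl (head-inSpan-tail c c≗0 c₀≢0 (supp ∘ suc)))
    ...   | false = ⊥-elim (c₀≢0 (supp zero refl))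

module Enumeration {q : ℕ} (F : FiniteField q) where

  open import Data.Nat using (_*_; _^_)

  open FiniteField F using (Carrier)
  open Inverse (FiniteField.enumeration F) using (to; from; strictlyInverseˡ)

  elements-unique : Unique (elements F)
  elements-unique =
    Uniqueₚ.map⁺ (Injection.injective (Inverse⇒Injection (FiniteField.enumeration F))) (Uniqueₚ.allFin⁺ q)

  ∈-elements : (x : Carrier) → x ∈ elements F
  ∈-elements x = Anyₚ.map⁺ (Any.map (λ { refl → sym (strictlyInverseˡ x) }) (∈-allFin (from x)))

  length-elements : length (elements F) ≡ q
  length-elements = trans (length-map to (allFin q)) (length-tabulate (λ i → i))

  ∈-allVecs : ∀ {n} (c : Vector Carrier n) → Any (_≗ c) (allVecs F n)
  ∈-allVecs {zero}  c = here (λ ())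
  ∈-allVecs {suc n} c = Anyₚ.concat⁺ (Anyₚ.map⁺ (Any.map
    (λ { refl → Anyₚ.map⁺ (Any.map (λ v≗ → λ { zero → refl ; (suc i) → v≗ i }) (∈-allVecs (c ∘ suc))) })
    (∈-elements (c zero))))

  Extensional : ∀ {m} → (Vector Carrier m → Bool) → Set
  Extensional p = ∀ {u w} → u ≗ w → p u ≡ p w

  count-allVecs-suc : ∀ {m} (p : Vector Carrier (suc m) → Bool) → Extensional p →
    count p (allVecs F (suc m)) ≡ ∑[ x ∈ elements F ] count (λ v → p (x ∷ᵛ v)) (allVecs F m)
  count-allVecs-suc {m} p p-ext =
    trans (sumBy-concatMap _ _ (elements F)) (sumBy-cong (λ x → trans (sumBy-map _ _ (allVecs F m))
      (sumBy-cong (λ v → cong 𝟙 (p-ext λ { zero → refl ; (suc i) → refl })) (allVecs F m))) (elements F))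

  length-allVecs : ∀ m → length (allVecs F m) ≡ q ^ m
  length-allVecs zero    = refl
  length-allVecs (suc m) = begin
    length (allVecs F (suc m))                              ≡⟨ count-true (allVecs F (suc m)) ⟨
    count (λ _ → true) (allVecs F (suc m))                  ≡⟨ count-allVecs-suc (λ _ → true) (λ _ → refl) ⟩
    ∑[ x ∈ elements F ] count (λ _ → true) (allVecs F m)    ≡⟨ sumBy-const _ (elements F) ⟩
    length (elements F) * count (λ _ → true) (allVecs F m)  ≡⟨ cong₂ _*_ length-elements count≡qᵐ ⟩
    q * q ^ m                                               ∎
    where
    open ≡-Reasoning
    count≡qᵐ = trans (count-true (allVecs F m)) (length-allVecs m)

module Decision {q : ℕ} (F : FiniteField q) where

  open LinearAlgebra F
  open Enumeration F

  supportedOn? : ∀ {n} (S : Vec Bool n) (c : Vector Carrier n) → Dec (SupportedOn S c)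
  supportedOn? S c = Finₚ.all? (λ i → (lookup S i Boolₚ.≟ false) →-dec (c i ≟ 0#))

  inSpan? : ∀ {n m} (B : Matrix F n m) (S : Vec Bool n) (w : Vector Carrier m) → Dec (InSpan B S w)
  inSpan? {n} B S w =
    map′ fromAny toAny (any? (λ c → supportedOn? S c ×-dec Finₚ.all? (λ j → lincomb c B j ≟ w j)) (allVecs F n))
    where
    fromAny : Any (λ c → SupportedOn S c × lincomb c B ≗ w) (allVecs F n) → InSpan B S w
    fromAny c∈ with Any.satisfied c∈
    ... | c , supp , eq = spanned c supp eq
    toAny : InSpan B S w → Any (λ c → SupportedOn S c × lincomb c B ≗ w) (allVecs F n)
    toAny (spanned c supp eq) =
      Any.map (λ c′≗c → (λ i i∉S → trans (c′≗c i) (supp i i∉S)) ,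
                        (λ j → trans (lincomb-cong B c′≗c j) (eq j)))
              (∈-allVecs c)

  inSpan?-extensional : ∀ {n m} (B : Matrix F n m) (S : Vec Bool n) → Extensional (does ∘ inSpan? B S)
  inSpan?-extensional B S u≗w =
    does-⇔ (inSpan? B S _) (inSpan? B S _) (mk⇔ (inSpan-resp u≗w) (inSpan-resp (sym ∘ u≗w)))

module RankCharacterisation {q : ℕ} (F : FiniteField q) where

  open import Data.Nat using (_⊔_)

  open LinearAlgebra F
  open Enumeration F

  allL≡true⇔All : {A : Set} (p : A → Bool) (xs : List A) → allL F p xs ≡ true ⇔ All (λ x → p x ≡ true) xs
  allL≡true⇔All p []       = mk⇔ (λ _ → []) (λ _ → refl)
  allL≡true⇔All p (x ∷ xs) with p x in px
  ... | true  = mk⇔ (λ h → px ∷ Equivalence.to (allL≡true⇔All p xs) h)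
                    (λ { (_ ∷ h) → Equivalence.from (allL≡true⇔All p xs) h })
  ... | false = mk⇔ (λ ()) (λ { (px′ ∷ _) → trans (sym px) px′ })

  allL≡false⇒Any : {A : Set} (p : A → Bool) (xs : List A) → allL F p xs ≡ false → Any (λ x → p x ≡ false) xs
  allL≡false⇒Any p (x ∷ xs) h with p x in px
  ... | true  = there (allL≡false⇒Any p xs h)
  ... | false = here px

  allFin?≡true⇔ : ∀ n {P : Fin n → Set} (p : Fin n → Bool) → (∀ i → p i ≡ true ⇔ P i) →
    allFin? F n p ≡ true ⇔ (∀ i → P i)
  allFin?≡true⇔ n p p⇔P = mk⇔
    (λ h i → Equivalence.to (p⇔P i) (All.lookup (Equivalence.to (allL≡true⇔All p (allFin n)) h) (∈-allFin i)))
    (λ h → Equivalence.from (allL≡true⇔All p (allFin n)) (All.tabulate (λ {i} _ → Equivalence.from (p⇔P i) (h i))))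

  isZero≡true⇔ : ∀ x → isZero F x ≡ true ⇔ x ≡ 0#
  isZero≡true⇔ x with x ≟ 0#
  ... | yes x≡0 = mk⇔ (λ _ → x≡0) (λ _ → refl)
  ... | no  x≢0 = mk⇔ (λ ()) (⊥-elim ∘ x≢0)

  ifFalse-isZero≡true⇔ : ∀ b x → (if b then true else isZero F x) ≡ true ⇔ (b ≡ false → x ≡ 0#)
  ifFalse-isZero≡true⇔ true  x = mk⇔ (λ _ ()) (λ _ → refl)
  ifFalse-isZero≡true⇔ false x = mk⇔ (λ h _ → Equivalence.to (isZero≡true⇔ x) h)
                                     (λ h → Equivalence.from (isZero≡true⇔ x) (h refl))

  independentRows⇔independent : ∀ {n m} (B : Matrix F n m) (S : Vec Bool n) →
    independentRows F B S ≡ true ⇔ Independent B S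
  independentRows⇔independent {n} {m} B S = mk⇔ sound complete
    where
    supported? combinesTo0? vanishes? : Vector Carrier n → Bool
    supported? c   = allFin? F n (λ i → if lookup S i then true else isZero F (c i))
    combinesTo0? c = allFin? F m (λ j → isZero F (lincomb c B j))
    vanishes? c    = allFin? F n (λ i → isZero F (c i))

    supported?⇔ : ∀ c → supported? c ≡ true ⇔ SupportedOn S c
    supported?⇔ c = allFin?≡true⇔ n _ (λ i → ifFalse-isZero≡true⇔ (lookup S i) (c i))
    combinesTo0?⇔ : ∀ c → combinesTo0? c ≡ true ⇔ lincomb c B ≗ 0ᵛ
    combinesTo0?⇔ c = allFin?≡true⇔ m _ (λ j → isZero≡true⇔ (lincomb c B j))
    vanishes?⇔ : ∀ c → vanishes? c ≡ true ⇔ c ≗ 0ᵛ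
    vanishes?⇔ c = allFin?≡true⇔ n _ (λ i → isZero≡true⇔ (c i))

    sound : independentRows F B S ≡ true → Independent B S
    sound h c supp c≗0 with All×Any⇒∃ (Equivalence.to (allL≡true⇔All _ (allVecs F n)) h) (∈-allVecs c)
    ... | c′ , ok , c′≗c with supported? c′ in s | combinesTo0? c′ in z
    ...   | false | _     = ⊥-elim (false≢true (trans (sym s)
                              (Equivalence.from (supported?⇔ c′) (λ i i∉S → trans (c′≗c i) (supp i i∉S)))))
    ...   | true  | false = ⊥-elim (false≢true (trans (sym z)
                              (Equivalence.from (combinesTo0?⇔ c′) (λ j → trans (lincomb-cong B c′≗c j) (c≗0 j)))))
    ...   | true  | true  = λ i → trans (sym (c′≗c i)) (Equivalence.to (vanishes?⇔ c′) ok i)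

    complete : Independent B S → independentRows F B S ≡ true
    complete ind with independentRows F B S in ir
    ... | true  = refl
    ... | false with Any.satisfied (allL≡false⇒Any _ (allVecs F n) ir)
    ...   | c , bad with supported? c in s | combinesTo0? c in z
    ...     | false | _     = ⊥-elim (false≢true (sym bad))
    ...     | true  | false = ⊥-elim (false≢true (sym bad))
    ...     | true  | true  = ⊥-elim (false≢true (trans (sym bad) (Equivalence.from (vanishes?⇔ c)
                                (ind c (Equivalence.to (supported?⇔ c) s) (Equivalence.to (combinesTo0?⇔ c) z)))))

  ∈-allSubsets : ∀ {n} (S : Vec Bool n) → S ∈ allSubsets F n
  ∈-allSubsets []      = here refl
  ∈-allSubsets (b ∷ S) = Anyₚ.concat⁺ (Anyₚ.map⁺ (Any.map (λ { refl → extend b }) (∈-allSubsets S)))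
    where
    extend : ∀ b → (b ∷ S) ∈ (true ∷ S) ∷ (false ∷ S) ∷ []
    extend true  = here refl
    extend false = there (here refl)

  size≤length : ∀ {n} (S : Vec Bool n) → size F S ≤ n
  size≤length []          = z≤n
  size≤length (true ∷ S)  = s≤s (size≤length S)
  size≤length (false ∷ S) = ℕₚ.m≤n⇒m≤1+n (size≤length S)

  size-replicate-false : ∀ n → size F (replicate n false) ≡ 0
  size-replicate-false zero    = refl
  size-replicate-false (suc n) = size-replicate-false n

  module _ {n m : ℕ} (B : Matrix F n m) where

    independent? : (S : Vec Bool n) → Dec (independentRows F B S ≡ true)
    independent? S = independentRows F B S Boolₚ.≟ true

    independent⇒size≤rank : {S : Vec Bool n} → Independent B S → size F S ≤ rank F B
    independent⇒size≤rank {S} ind = ≤-foldr-⊔ (∈-map⁺ (size F)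
      (∈-filter⁺ independent? (∈-allSubsets S) (Equivalence.from (independentRows⇔independent B S) ind)))

    rank-attained : ∃ λ S → Independent B S × size F S ≡ rank F B
    rank-attained with foldr-selective ℕₚ.⊔-sel 0 (List.map (size F) (filter independent? (allSubsets F n)))
    ... | inj₁ rank≡0 = replicate n false , (λ c supp _ i → supp i (lookup-replicate i false)) ,
                        trans (size-replicate-false n) (sym rank≡0)
    ... | inj₂ rank∈ with ∈-map⁻ (size F) rank∈
    ...   | S , S∈ , rank≡size =
      S , Equivalence.to (independentRows⇔independent B S) (proj₂ (∈-filter⁻ independent? {xs = allSubsets F n} S∈)) ,
      sym rank≡size

    rank≤rows : rank F B ≤ n
    rank≤rows with rank-attained
    ... | S , _ , size≡rank = subst (_≤ n) size≡rank (size≤length S)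

module SpanCount {q : ℕ} (F : FiniteField q) where

  open import Data.Nat using (_^_) renaming (_*_ to _*ℕ_)

  open LinearAlgebra F
  open Enumeration F
  open Decision F
  open ≡-Reasoning

  ∑-translate : (g : Carrier → ℕ) (c : Carrier) → ∑[ x ∈ elements F ] g (x + c) ≡ sumBy g (elements F)
  ∑-translate g c = begin
    ∑[ x ∈ E ] g (x + c)                                   ≡⟨ sumBy-cong pick E ⟩
    ∑[ x ∈ E ] ∑[ y ∈ E ] (𝟙 (does (y ≟ (x + c))) *ℕ g y)  ≡⟨ sumBy-comm _ E E ⟩
    ∑[ y ∈ E ] ∑[ x ∈ E ] (𝟙 (does (y ≟ (x + c))) *ℕ g y)  ≡⟨ sumBy-cong unpick E ⟩
    sumBy g E                                              ∎
    where
    E = elements F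
    pick : ∀ x → g (x + c) ≡ ∑[ y ∈ E ] (𝟙 (does (y ≟ (x + c))) *ℕ g y)
    pick x = sym (sumBy-indicator _≟_ g elements-unique (∈-elements (x + c)))
    unpick : ∀ y → ∑[ x ∈ E ] (𝟙 (does (y ≟ (x + c))) *ℕ g y) ≡ g y
    unpick y = trans
      (sumBy-cong (λ x → cong (λ b → 𝟙 b *ℕ g y) (does-⇔ (y ≟ (x + c)) (x ≟ (y - c)) (mk⇔
        (λ y≡x+c → x+y≡z⇒y≡z-x (trans (+-comm c x) (sym y≡x+c)))
        (λ x≡y-c → sym (trans (cong (_+ c) x≡y-c) (//-rightDividesˡ c y)))))) E)
      (sumBy-indicator _≟_ (λ _ → g y) elements-unique (∈-elements (y - c)))

  count-translate : ∀ {m} (p : Vector Carrier m → Bool) → Extensional p → (x : Vector Carrier m) →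
    count (λ w → p (λ j → w j + x j)) (allVecs F m) ≡ count p (allVecs F m)
  count-translate {zero}  p p-ext x = cong (λ b → 𝟙 b ℕ.+ 0) (p-ext (λ ()))
  count-translate {suc m} p p-ext x = begin
    count (λ w → p (λ j → w j + x j)) (allVecs F (suc m))
      ≡⟨ count-allVecs-suc _ (λ u≗w → p-ext (λ j → cong (_+ x j) (u≗w j))) ⟩
    ∑[ y ∈ E ] count (λ w → p (λ j → (y ∷ᵛ w) j + x j)) (allVecs F m)
      ≡⟨ sumBy-cong (λ y → sumBy-cong (λ w → cong 𝟙 (p-ext (cons-+ y w))) (allVecs F m)) E ⟩
    ∑[ y ∈ E ] count (λ w → p ((y + head x) ∷ᵛ (λ j → w j + tail x j))) (allVecs F m)
      ≡⟨ sumBy-cong (λ y → count-translate (p ∘ ((y + head x) ∷ᵛ_)) (p-ext ∘ cons-cong) (tail x)) E ⟩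
    ∑[ y ∈ E ] g (y + head x)  ≡⟨ ∑-translate g (head x) ⟩
    sumBy g E                  ≡⟨ count-allVecs-suc p p-ext ⟨
    count p (allVecs F (suc m)) ∎
    where
    E = elements F
    g : Carrier → ℕ
    g y = count (p ∘ (y ∷ᵛ_)) (allVecs F m)
    cons-cong : ∀ {y} {u w : Vector Carrier m} → u ≗ w → y ∷ᵛ u ≗ y ∷ᵛ w
    cons-cong u≗w zero    = refl
    cons-cong u≗w (suc j) = u≗w j
    cons-+ : ∀ y w → (λ j → (y ∷ᵛ w) j + x j) ≗ (y + head x) ∷ᵛ (λ j → w j + tail x j)
    cons-+ y w zero    = refl
    cons-+ y w (suc j) = refl

  count-only-zero : ∀ {m} (p : Vector Carrier m → Bool) → Extensional p →
    (∀ w → p w ≡ true → w ≗ 0ᵛ) → p 0ᵛ ≡ true → count p (allVecs F m) ≡ 1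
  count-only-zero {zero}  p p-ext only-0 p0 = cong (λ b → 𝟙 b ℕ.+ 0) (trans (p-ext (λ ())) p0)
  count-only-zero {suc m} p p-ext only-0 p0 = begin
    count p (allVecs F (suc m))                   ≡⟨ count-allVecs-suc p p-ext ⟩
    ∑[ y ∈ E ] count (p ∘ (y ∷ᵛ_)) (allVecs F m)  ≡⟨ sumBy-cong row E ⟩
    ∑[ y ∈ E ] (𝟙 (does (y ≟ 0#)) *ℕ 1)           ≡⟨ sumBy-indicator _≟_ (λ _ → 1) elements-unique (∈-elements 0#) ⟩
    1                                             ∎
    where
    E = elements F
    row : ∀ y → count (p ∘ (y ∷ᵛ_)) (allVecs F m) ≡ 𝟙 (does (y ≟ 0#)) *ℕ 1
    row y with y ≟ 0#
    ... | yes refl = count-only-zero (p ∘ (0# ∷ᵛ_)) (λ u≗w → p-ext λ { zero → refl ; (suc j) → u≗w j })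
                       (λ w pw j → only-0 _ pw (suc j)) (trans (p-ext λ { zero → refl ; (suc j) → refl }) p0)
    ... | no y≢0   = sumBy-zero off (allVecs F m)
      where
      off : ∀ w → 𝟙 (p (y ∷ᵛ w)) ≡ 0
      off w with p (y ∷ᵛ w) in pw
      ... | true  = ⊥-elim (y≢0 (only-0 _ pw zero))
      ... | false = refl

  -- w ↦ w -[ t ]· v is a translation, and each w arises from at most one t.
  count-shifts : ∀ {m} (p p′ : Vector Carrier m → Bool) (v : Vector Carrier m) → Extensional p →
    (∀ w → p′ w ≡ true ⇔ Any (λ t → p (w -[ t ]· v) ≡ true) (elements F)) →
    (∀ w t s → p (w -[ t ]· v) ≡ true → p (w -[ s ]· v) ≡ true → t ≡ s) →
    count p′ (allVecs F m) ≡ q *ℕ count p (allVecs F m)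
  count-shifts {m} p p′ v p-ext p′⇔ unique = begin
    count p′ V
      ≡⟨ sumBy-cong (λ w → 𝟙≡count elements-unique (unique w) (p′⇔ w)) V ⟩
    ∑[ w ∈ V ] count (λ t → p (w -[ t ]· v)) E
      ≡⟨ sumBy-comm _ V E ⟩
    ∑[ t ∈ E ] count (λ w → p (w -[ t ]· v)) V
      ≡⟨ sumBy-cong (λ t → count-translate p p-ext (λ j → - (t * v j))) E ⟩
    ∑[ t ∈ E ] count p V
      ≡⟨ sumBy-const _ E ⟩
    length E *ℕ count p V
      ≡⟨ cong (_*ℕ count p V) length-elements ⟩
    q *ℕ count p V
      ∎
    where
    V = allVecs F m
    E = elements F

  count-span : ∀ {n m} (B : Matrix F n m) (S : Vec Bool n) → Independent B S →
    count (does ∘ inSpan? B S) (allVecs F m) ≡ q ^ size F S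
  count-span {zero} B [] ind = count-only-zero _ (inSpan?-extensional B [])
    (λ w w∈ j → sym (InSpan.combines (Equivalence.to (does≡true⇔ (inSpan? B [] w)) w∈) j))
    (Equivalence.from (does≡true⇔ (inSpan? B [] 0ᵛ)) (spanned (λ ()) (λ ()) (λ j → refl)))
  count-span {suc n} {m} B (false ∷ S) ind = trans
    (sumBy-cong (λ w → cong 𝟙 (does-⇔ (inSpan? B (false ∷ S) w) (inSpan? (tail B) S w)
                                 (mk⇔ (inSpan-false∷⇒tail B) (inSpan-tail⇒false∷ B)))) (allVecs F m))
    (count-span (tail B) S (independent-tail B ind))
  count-span {suc n} {m} B (true ∷ S) ind = trans
    (count-shifts (does ∘ inSpan? (tail B) S) (does ∘ inSpan? B (true ∷ S)) (head B) (inSpan?-extensional (tail B) S)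
                  shifted⇔ unique)
    (cong (q *ℕ_) (count-span (tail B) S (independent-tail B ind)))
    where
    shifted⇔ : ∀ w → does (inSpan? B (true ∷ S) w) ≡ true ⇔
                     Any (λ t → does (inSpan? (tail B) S (w -[ t ]· head B)) ≡ true) (elements F)
    shifted⇔ w = mk⇔
      (λ w∈ → let t , _ , rest∈ = inSpan-∷⁻ B (Equivalence.to (does≡true⇔ (inSpan? B (true ∷ S) w)) w∈) in
              Any.map (λ { refl → Equivalence.from (does≡true⇔ (inSpan? (tail B) S _)) rest∈ }) (∈-elements t))
      (λ t∈ → let t , rest∈ = Any.satisfied t∈ in
              Equivalence.from (does≡true⇔ (inSpan? B (true ∷ S) w))
                (inSpan-∷⁺ B (λ ()) (Equivalence.to (does≡true⇔ (inSpan? (tail B) S _)) rest∈)))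
    unique : ∀ w t s → does (inSpan? (tail B) S (w -[ t ]· head B)) ≡ true →
                       does (inSpan? (tail B) S (w -[ s ]· head B)) ≡ true → t ≡ s
    unique w t s t-ok s-ok with Equivalence.to (does≡true⇔ (inSpan? (tail B) S _)) t-ok
                              | Equivalence.to (does≡true⇔ (inSpan? (tail B) S _)) s-ok
    ... | spanned c suppc eqc | spanned d suppd eqd =
      independent⇒lincomb-injective {B = B} {S = true ∷ S} ind {t ∷ᵛ c} {s ∷ᵛ d}
        (λ { zero () ; (suc i) → suppc i }) (λ { zero () ; (suc i) → suppd i })
        (λ j → trans (lincomb-∷ B eqc j) (sym (lincomb-∷ B eqd j))) zero

1<field-size : ∀ {q} → FiniteField q → 1 < q
1<field-size {zero}        F with () ← Inverse.from (FiniteField.enumeration F) (FiniteField.0# F)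
1<field-size {suc zero}    F =
  ⊥-elim (0≢1 (trans (sym (strictlyInverseˡ 0#)) (trans (cong to (Fin1-irrelevant _ _)) (strictlyInverseˡ 1#))))
  where
  open FiniteField F using (0≢1; 0#; 1#)
  open Inverse (FiniteField.enumeration F) using (to; strictlyInverseˡ)
  Fin1-irrelevant : (i j : Fin 1) → i ≡ j
  Fin1-irrelevant zero zero = refl
1<field-size {suc (suc _)} F = s≤s (s≤s z≤n)

module RowSpace {q : ℕ} (F : FiniteField q) where

  open import Data.Nat using (_^_; _≤?_)

  open LinearAlgebra F
  open Enumeration F
  open Decision F
  open RankCharacterisation F
  open SpanCount F

  ^-cancelʳ-≤ : ∀ {a b} → q ^ a ≤ q ^ b → a ≤ b
  ^-cancelʳ-≤ {a} {b} qᵃ≤qᵇ with a ≤? b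
  ... | yes a≤b = a≤b
  ... | no  a≰b = ⊥-elim (ℕₚ.<⇒≱ (ℕₚ.^-monoʳ-< q (1<field-size F) (ℕₚ.≰⇒> a≰b)) qᵃ≤qᵇ)

  InRowSpace : ∀ {n m} → Matrix F n m → Vector Carrier m → Set
  InRowSpace {n} B = InSpan B (replicate n true)

  inRowSpace? : ∀ {n m} (B : Matrix F n m) (w : Vector Carrier m) → Dec (InRowSpace B w)
  inRowSpace? {n} B = inSpan? B (replicate n true)

  inSpan⇒inRowSpace : ∀ {n m} {B : Matrix F n m} {S : Vec Bool n} {w} → InSpan B S w → InRowSpace B w
  inSpan⇒inRowSpace (spanned c _ eq) =
    spanned c (λ i i∉ → ⊥-elim (false≢true (trans (sym i∉) (lookup-replicate i true)))) eq

  Spans : ∀ {n m} → Matrix F n m → Vec Bool n → Set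
  Spans B S = ∀ {w} → InRowSpace B w → InSpan B S w

  IsBasis : ∀ {n m} → Matrix F n m → Vec Bool n → Set
  IsBasis B S = Independent B S × Spans B S

  basis-∷ : ∀ {n m} (B : Matrix F (suc n) m) {T : Vec Bool n} → IsBasis (tail B) T →
    ∃ λ S → IsBasis B S × size F S ≡ size F T ℕ.+ 𝟙 (not (does (inRowSpace? (tail B) (head B))))
  basis-∷ {n} B {T} (indT , spansT) = extend (inRowSpace? (tail B) (head B))
    where
    extend : (head∈? : Dec (InRowSpace (tail B) (head B))) →
      ∃ λ S → IsBasis B S × size F S ≡ size F T ℕ.+ 𝟙 (not (does head∈?))
    extend (yes head∈) = false ∷ T , (independent-∷ B indT (λ ()) , spans) , sym (ℕₚ.+-identityʳ (size F T))
      where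
      spans : Spans B (false ∷ T)
      spans w∈ with inSpan-∷⁻ B w∈
      ... | t , _ , rest∈ = inSpan-tail⇒false∷ B (inSpan-resp (λ j → //-rightDividesˡ (t * head B j) _)
                              (inSpan-+ (spansT rest∈) (inSpan-*ˡ t (spansT head∈))))
    extend (no head∉)  = true ∷ T , (independent-∷ B indT (λ _ → head∉ ∘ inSpan⇒inRowSpace) , spans) ,
                         ℕₚ.+-comm 1 (size F T)
      where
      spans : Spans B (true ∷ T)
      spans w∈ with inSpan-∷⁻ B w∈
      ... | t , _ , rest∈ = inSpan-∷⁺ B (λ ()) (spansT rest∈)

  basis-exists : ∀ {n m} (B : Matrix F n m) → ∃ (IsBasis B)
  basis-exists {zero}  B = [] , (λ c _ _ ()) , (λ w∈ → w∈)
  basis-exists {suc n} B with basis-exists (tail B)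
  ... | T , basisT with basis-∷ B basisT
  ...   | S , basisS , _ = S , basisS

  count-basis-span : ∀ {n m} (B : Matrix F n m) {S : Vec Bool n} → IsBasis B S →
    count (does ∘ inRowSpace? B) (allVecs F m) ≡ q ^ size F S
  count-basis-span {n} {m} B {S} (indS , spansS) = trans
    (sumBy-cong (λ w → cong 𝟙 (does-⇔ (inRowSpace? B w) (inSpan? B S w) (mk⇔ spansS inSpan⇒inRowSpace)))
                (allVecs F m))
    (count-span B S indS)

  rank-basis : ∀ {n m} (B : Matrix F n m) {S : Vec Bool n} → IsBasis B S → rank F B ≡ size F S
  rank-basis {n} {m} B {S} (indS , spansS) with rank-attained B
  ... | S′ , indS′ , size≡rank = ℕₚ.≤-antisym
    (subst (_≤ size F S) size≡rank (^-cancelʳ-≤ (subst₂ _≤_ (count-span B S′ indS′) (count-span B S indS)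
      (count-mono (λ w w∈ → Equivalence.from (does≡true⇔ (inSpan? B S w))
                     (spansS (inSpan⇒inRowSpace (Equivalence.to (does≡true⇔ (inSpan? B S′ w)) w∈))))
                  (allVecs F m)))))
    (independent⇒size≤rank B {S} indS)

  rank-∷ : ∀ {n m} (B : Matrix F (suc n) m) →
    rank F B ≡ rank F (tail B) ℕ.+ 𝟙 (not (does (inRowSpace? (tail B) (head B))))
  rank-∷ B with basis-exists (tail B)
  ... | T , basisT with basis-∷ B basisT
  ...   | S , basisS , size≡ =
    trans (rank-basis B basisS) (trans size≡ (cong (ℕ._+ _) (sym (rank-basis (tail B) basisT))))

  count-rowSpace : ∀ {n m} (B : Matrix F n m) → count (does ∘ inRowSpace? B) (allVecs F m) ≡ q ^ rank F B
  count-rowSpace B with basis-exists B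
  ... | S , basisS = trans (count-basis-span B basisS) (cong (q ^_) (sym (rank-basis B basisS)))

module RankRecurrence {q : ℕ} (F : FiniteField q) {m : ℕ} where

  open import Data.Nat using (_+_; _*_; _^_; _≟_; _≡ᵇ_)
  open import Data.Nat.Properties

  open Enumeration F
  open RankCharacterisation F
  open RowSpace F

  inside outside : ∀ {n} → Matrix F n m → ℕ
  inside  A = count (does ∘ inRowSpace? A) (allVecs F m)
  outside A = count (not ∘ does ∘ inRowSpace? A) (allVecs F m)

  inside+outside : ∀ {n} (A : Matrix F n m) → inside A + outside A ≡ q ^ m
  inside+outside A = trans (count+count-not (does ∘ inRowSpace? A) (allVecs F m)) (length-allVecs m)

  R≡count : ∀ n r → R F n m r ≡ count (λ A → does (rank F A ≟ r)) (allMatrices F n m)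
  R≡count n r = length-filter≡count (λ A → rank F A ≟ r) (allMatrices F n m)

  R-suc : ∀ n r → R F (suc n) m r ≡
    ∑[ A ∈ allMatrices F n m ] (δ (rank F A) r * inside A + δ (suc (rank F A)) r * outside A)
  R-suc n r = begin
    R F (suc n) m r
      ≡⟨ R≡count (suc n) r ⟩
    count (λ B → does (rank F B ≟ r)) (allMatrices F (suc n) m)
      ≡⟨ sumBy-cong (λ B → cong (λ k → δ k r) (rank-∷ B)) (allMatrices F (suc n) m) ⟩
    ∑[ B ∈ allMatrices F (suc n) m ] δ (rank F (tail B) + 𝟙 (not (does (inRowSpace? (tail B) (head B))))) r
      ≡⟨ sumBy-concatMap _ _ (allVecs F m) ⟩
    _ ≡⟨ sumBy-cong (λ v → sumBy-map _ _ (allMatrices F n m)) (allVecs F m) ⟩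
    ∑[ v ∈ allVecs F m ] ∑[ A ∈ allMatrices F n m ] δ (rank F A + 𝟙 (not (does (inRowSpace? A v)))) r
      ≡⟨ sumBy-comm _ (allVecs F m) (allMatrices F n m) ⟩
    ∑[ A ∈ allMatrices F n m ] ∑[ v ∈ allVecs F m ] δ (rank F A + 𝟙 (not (does (inRowSpace? A v)))) r
      ≡⟨ sumBy-cong split (allMatrices F n m) ⟩
    ∑[ A ∈ allMatrices F n m ] (δ (rank F A) r * inside A + δ (suc (rank F A)) r * outside A) ∎
    where
    open ≡-Reasoning
    split : ∀ A → ∑[ v ∈ allVecs F m ] δ (rank F A + 𝟙 (not (does (inRowSpace? A v)))) r
                ≡ δ (rank F A) r * inside A + δ (suc (rank F A)) r * outside A
    split A = trans (sumBy-cong (λ v → δ-+𝟙 (rank F A) r (does (inRowSpace? A v))) (allVecs F m))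
      (trans (sumBy-+ _ _ (allVecs F m))
             (cong₂ _+_ (sumBy-*ˡ (δ (rank F A) r) (𝟙 ∘ does ∘ inRowSpace? A) (allVecs F m))
                        (sumBy-*ˡ (δ (suc (rank F A)) r) (𝟙 ∘ not ∘ does ∘ inRowSpace? A) (allVecs F m))))

  -- For a matrix A: k = rank A, K = inside A, N = outside A.
  row-zero : ∀ k {K N} → K ≡ q ^ k → δ k 0 * K + δ (suc k) 0 * N ≡ δ k 0
  row-zero zero    {K} K≡1 = trans (+-identityʳ (K + 0)) (trans (+-identityʳ K) K≡1)
  row-zero (suc k) _       = refl

  row-suc : ∀ k s {K N} → K ≡ q ^ k → K + N ≡ q ^ m →
    δ k (suc s) * K + δ (suc k) (suc s) * N + δ k s * q ^ s ≡ δ k (suc s) * q ^ suc s + δ k s * q ^ m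
  row-suc k s {K} {N} K≡ K+N≡ with k ≟ s
  ... | yes refl rewrite ≢⇒≡ᵇ-false {k} {suc k} (1+n≢n ∘ sym) | ≡ᵇ-refl k =
    trans (cong₂ _+_ (+-identityʳ N) (+-identityʳ (q ^ k)))
          (trans (+-comm N (q ^ k)) (trans (cong (_+ N) (sym K≡)) (trans K+N≡ (sym (+-identityʳ (q ^ m))))))
  ... | no k≢s with k ≟ suc s
  ...   | yes refl rewrite ≡ᵇ-refl s | ≢⇒≡ᵇ-false {suc s} {s} 1+n≢n =
    trans (+-identityʳ _) (trans (+-identityʳ _) (trans (+-identityʳ K)
      (trans K≡ (sym (trans (+-identityʳ _) (+-identityʳ _))))))
  ...   | no k≢1+s rewrite ≢⇒≡ᵇ-false k≢1+s | ≢⇒≡ᵇ-false k≢s = refl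

  R-suc-zero : ∀ n → R F (suc n) m 0 ≡ R F n m 0
  R-suc-zero n = trans (R-suc n 0)
    (trans (sumBy-cong (λ A → row-zero (rank F A) {N = outside A} (count-rowSpace A)) (allMatrices F n m))
           (sym (R≡count n 0)))

  -- R(n+1,s+1) = R(n,s+1) q^(s+1) + R(n,s) (q^m - q^s), with the subtraction moved across.
  R-suc-suc : ∀ n s →
    R F (suc n) m (suc s) + R F n m s * q ^ s ≡ R F n m (suc s) * q ^ suc s + R F n m s * q ^ m
  R-suc-suc n s = begin
    R F (suc n) m (suc s) + R F n m s * q ^ s
      ≡⟨ cong₂ _+_ (R-suc n (suc s)) (trans (cong (_* q ^ s) (R≡count n s)) (sym (sumBy-*ʳ (q ^ s) _ As))) ⟩
    ∑[ A ∈ As ] (δ (rank F A) (suc s) * inside A + δ (suc (rank F A)) (suc s) * outside A)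
      + ∑[ A ∈ As ] (δ (rank F A) s * q ^ s)
      ≡⟨ sumBy-+ _ _ As ⟨
    _ ≡⟨ sumBy-cong (λ A → row-suc (rank F A) s (count-rowSpace A) (inside+outside A)) As ⟩
    ∑[ A ∈ As ] (δ (rank F A) (suc s) * q ^ suc s + δ (rank F A) s * q ^ m)
      ≡⟨ sumBy-+ _ _ As ⟩
    _ ≡⟨ cong₂ _+_ (trans (sumBy-*ʳ (q ^ suc s) _ As) (cong (_* q ^ suc s) (sym (R≡count n (suc s)))))
                   (trans (sumBy-*ʳ (q ^ m) _ As) (cong (_* q ^ m) (sym (R≡count n s)))) ⟩
    R F n m (suc s) * q ^ suc s + R F n m s * q ^ m ∎
    where
    open ≡-Reasoning
    As = allMatrices F n m

  R-above : ∀ n r → n < r → R F n m r ≡ 0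
  R-above n r n<r = trans (R≡count n r)
    (sumBy-zero (λ A → cong 𝟙 (≢⇒≡ᵇ-false (λ rank≡r → <⇒≱ n<r (subst (_≤ n) rank≡r (rank≤rows A)))))
                (allMatrices F n m))

  R-empty : R F 0 m 0 ≡ 1
  R-empty = trans (R≡count 0 0)
    (trans (sumBy-cong (λ A → cong 𝟙 (dec-true (rank F A ≟ 0) (n≤0⇒n≡0 (rank≤rows A)))) (allMatrices F 0 m))
           (sumBy-const 1 (allMatrices F 0 m)))

module PochhammerSums where

  open import Data.Integer using (ℤ; +_; _+_; _-_; _*_; _^_; 1ℤ; 0ℤ)
  open import Data.Integer.Properties
    using (+-identityˡ; +-identityʳ; +-assoc; *-identityʳ; *-distribʳ-+; *-comm; *-assoc; ^-distribˡ-+-*; pos-+; pos-*)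
  open import Data.Integer.Tactic.RingSolver using (solve-∀)
  open import Data.Nat using (_∸_)

  sumTo-cong : ∀ a {f g : ℕ → ℤ} → (∀ r → r ≤ a → f r ≡ g r) → sumTo a f ≡ sumTo a g
  sumTo-cong zero    f≡g = f≡g 0 z≤n
  sumTo-cong (suc a) f≡g =
    cong₂ _+_ (sumTo-cong a (λ r r≤a → f≡g r (ℕₚ.m≤n⇒m≤1+n r≤a))) (f≡g (suc a) ℕₚ.≤-refl)

  sumTo-+ : ∀ a (f g : ℕ → ℤ) → sumTo a (λ r → f r + g r) ≡ sumTo a f + sumTo a g
  sumTo-+ zero    f g = refl
  sumTo-+ (suc a) f g = trans (cong (_+ (f (suc a) + g (suc a))) (sumTo-+ a f g))
                              (interchange (sumTo a f) (sumTo a g) (f (suc a)) (g (suc a)))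
    where
    interchange : ∀ w x y z → w + x + (y + z) ≡ w + y + (x + z)
    interchange = solve-∀

  sumTo-*ʳ : ∀ a (f : ℕ → ℤ) (c : ℤ) → sumTo a (λ r → f r * c) ≡ sumTo a f * c
  sumTo-*ʳ zero    f c = refl
  sumTo-*ʳ (suc a) f c = trans (cong (_+ f (suc a) * c) (sumTo-*ʳ a f c)) (sym (*-distribʳ-+ c (sumTo a f) (f (suc a))))

  sumTo-suc : ∀ a (f : ℕ → ℤ) → sumTo (suc a) f ≡ f 0 + sumTo a (f ∘′ suc)
  sumTo-suc zero    f = refl
  sumTo-suc (suc a) f = trans (cong (_+ f (suc (suc a))) (sumTo-suc a f)) (+-assoc (f 0) _ _)

  sumTo-head : ∀ a (f : ℕ → ℤ) → (∀ r → f (suc r) ≡ 0ℤ) → sumTo a f ≡ f 0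
  sumTo-head zero    f f≡0 = refl
  sumTo-head (suc a) f f≡0 = trans (cong₂ _+_ (sumTo-head a f f≡0) (f≡0 a)) (+-identityʳ (f 0))

  factor-step : ∀ ρ xʳ P T M → ρ * xʳ * (P * (1ℤ - T)) + ρ * (M - xʳ) * P ≡ ρ * P * (M - xʳ * T)
  factor-step = solve-∀

  factor-closed : ∀ M W A B T → (M - M * T) * (W * A * B) ≡ M * W * A * (B * (1ℤ - T))
  factor-closed = solve-∀

  -- ρ n r stands for R(n,m,r) at x = q; only its recurrence is used.
  module RankSum (x : ℤ) (m : ℕ) (ρ : ℕ → ℕ → ℤ)
    (ρ-empty    : ρ 0 0 ≡ 1ℤ)
    (ρ-above    : ∀ n r → n < r → ρ n r ≡ 0ℤ)
    (ρ-suc-zero : ∀ n → ρ (suc n) 0 ≡ ρ n 0)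
    (ρ-suc-suc  : ∀ n s → ρ (suc n) (suc s) ≡ ρ n (suc s) * x ^ suc s + ρ n s * (x ^ m - x ^ s))
    where

    open ≡-Reasoning

    P : ℕ → ℤ
    P = poch x x

    Φ : ℕ → ℕ → ℤ
    Φ n a = sumTo a (λ r → ρ n r * P (a ∸ r))

    Δ : ℕ → ℕ → ℤ
    Δ n zero    = 0ℤ
    Δ n (suc s) = ρ n s * (x ^ m - x ^ s)

    ρ-suc : ∀ n r → ρ (suc n) r ≡ ρ n r * x ^ r + Δ n r
    ρ-suc n zero    = trans (ρ-suc-zero n) (sym (trans (+-identityʳ _) (*-identityʳ (ρ n 0))))
    ρ-suc n (suc s) = ρ-suc-suc n s

    x^r*x^[a∸r+1]≡x^[a+1] : ∀ {r a} → r ≤ a → x ^ r * (x * x ^ (a ∸ r)) ≡ x ^ suc a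
    x^r*x^[a∸r+1]≡x^[a+1] {r} {a} r≤a =
      trans (sym (^-distribˡ-+-* x r (suc (a ∸ r))))
            (cong (x ^_) (trans (ℕₚ.+-suc r (a ∸ r)) (cong suc (ℕₚ.m+[n∸m]≡n r≤a))))

    Φ-suc : ∀ n a → n ≤ a → Φ (suc n) (suc a) ≡ (x ^ m - x ^ suc a) * Φ n a
    Φ-suc n a n≤a = begin
      Φ (suc n) (suc a)
        ≡⟨ sumTo-cong (suc a) (λ r _ → trans (cong (_* P (suc a ∸ r)) (ρ-suc n r))
                                             (*-distribʳ-+ (P (suc a ∸ r)) (ρ n r * x ^ r) (Δ n r))) ⟩
      sumTo (suc a) (λ r → g r + h r)             ≡⟨ sumTo-+ (suc a) g h ⟩
      sumTo (suc a) g + sumTo (suc a) h           ≡⟨ cong₂ _+_ g-last (sumTo-suc a h) ⟩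
      sumTo a g + (0ℤ + sumTo a (h ∘′ suc))       ≡⟨ cong (λ y → sumTo a g + y) (+-identityˡ _) ⟩
      sumTo a g + sumTo a (h ∘′ suc)              ≡⟨ sumTo-+ a g (h ∘′ suc) ⟨
      sumTo a (λ r → g r + h (suc r))             ≡⟨ sumTo-cong a combine ⟩
      sumTo a (λ r → ρ n r * P (a ∸ r) * (x ^ m - x ^ suc a)) ≡⟨ sumTo-*ʳ a _ _ ⟩
      Φ n a * (x ^ m - x ^ suc a)                 ≡⟨ *-comm (Φ n a) _ ⟩
      (x ^ m - x ^ suc a) * Φ n a                 ∎
      where
      g h : ℕ → ℤ
      g r = ρ n r * x ^ r * P (suc a ∸ r)
      h r = Δ n r * P (suc a ∸ r)
      g-last : sumTo (suc a) g ≡ sumTo a g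
      g-last = trans (cong (λ ρₙ → sumTo a g + ρₙ * x ^ suc a * P (a ∸ a)) (ρ-above n (suc a) (s≤s n≤a)))
                     (+-identityʳ (sumTo a g))
      combine : ∀ r → r ≤ a → g r + h (suc r) ≡ ρ n r * P (a ∸ r) * (x ^ m - x ^ suc a)
      combine r r≤a = begin
        g r + h (suc r)
          ≡⟨ cong (λ k → ρ n r * x ^ r * P k + h (suc r)) (ℕₚ.+-∸-assoc 1 r≤a) ⟩
        ρ n r * x ^ r * (P (a ∸ r) * (1ℤ - x * x ^ (a ∸ r))) + ρ n r * (x ^ m - x ^ r) * P (a ∸ r)
          ≡⟨ factor-step (ρ n r) (x ^ r) (P (a ∸ r)) (x * x ^ (a ∸ r)) (x ^ m) ⟩
        ρ n r * P (a ∸ r) * (x ^ m - x ^ r * (x * x ^ (a ∸ r)))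
          ≡⟨ cong (λ y → ρ n r * P (a ∸ r) * (x ^ m - y)) (x^r*x^[a∸r+1]≡x^[a+1] r≤a) ⟩
        ρ n r * P (a ∸ r) * (x ^ m - x ^ suc a) ∎

    Φ-closed : ∀ n a → n ℕ.+ m ≤ a → Φ n a * P (a ∸ n ∸ m) ≡ x ^ (n ℕ.* m) * P (a ∸ n) * P (a ∸ m)
    Φ-closed zero a _ = cong (_* P (a ∸ m)) (begin
      Φ 0 a        ≡⟨ sumTo-head a _ (λ r → cong (_* P (a ∸ suc r)) (ρ-above 0 (suc r) (s≤s z≤n))) ⟩
      ρ 0 0 * P a  ≡⟨ cong (_* P a) ρ-empty ⟩
      1ℤ * P a     ∎)
    Φ-closed (suc n) (suc a) (s≤s n+m≤a) = begin
      Φ (suc n) (suc a) * P (a ∸ n ∸ m)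
        ≡⟨ cong (_* P (a ∸ n ∸ m)) (Φ-suc n a (ℕₚ.≤-trans (ℕₚ.m≤m+n n m) n+m≤a)) ⟩
      (M - x ^ suc a) * Φ n a * P (a ∸ n ∸ m)
        ≡⟨ *-assoc (M - x ^ suc a) (Φ n a) _ ⟩
      (M - x ^ suc a) * (Φ n a * P (a ∸ n ∸ m))
        ≡⟨ cong₂ (λ y z → (M - y) * z) (sym (x^r*x^[a∸r+1]≡x^[a+1] m≤a)) (Φ-closed n a n+m≤a) ⟩
      (M - M * T) * (x ^ (n ℕ.* m) * P (a ∸ n) * P (a ∸ m))
        ≡⟨ factor-closed M (x ^ (n ℕ.* m)) (P (a ∸ n)) (P (a ∸ m)) T ⟩
      M * x ^ (n ℕ.* m) * P (a ∸ n) * (P (a ∸ m) * (1ℤ - T))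
        ≡⟨ cong₂ (λ y k → y * P (a ∸ n) * P k) (sym (^-distribˡ-+-* x m (n ℕ.* m))) (sym (ℕₚ.+-∸-assoc 1 m≤a)) ⟩
      x ^ (m ℕ.+ n ℕ.* m) * P (a ∸ n) * P (suc a ∸ m) ∎
      where
      M = x ^ m
      T = x * x ^ (a ∸ m)
      m≤a : m ≤ a
      m≤a = ℕₚ.≤-trans (ℕₚ.m≤n+m m n) n+m≤a

  pos-^ : ∀ q k → + (q ℕ.^ k) ≡ (+ q) ^ k
  pos-^ q zero    = refl
  pos-^ q (suc k) = trans (pos-* q (q ℕ.^ k)) (cong (+ q *_) (pos-^ q k))

  move-to-difference : ∀ {a b c d e : ℕ} → a ℕ.+ b ℕ.* c ≡ d ℕ.+ b ℕ.* e → + a ≡ + d + + b * (+ e - + c)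
  move-to-difference {a} {b} {c} {d} {e} eq = begin
    + a                               ≡⟨ add-sub (+ a) (+ b * + c) ⟩
    (+ a + + b * + c) - + b * + c     ≡⟨ cong (λ y → (+ a + y) - + b * + c) (pos-* b c) ⟨
    (+ a + + (b ℕ.* c)) - + b * + c   ≡⟨ cong (_- + b * + c) (trans (sym (pos-+ a (b ℕ.* c))) (cong +_ eq)) ⟩
    + (d ℕ.+ b ℕ.* e) - + b * + c     ≡⟨ cong (_- + b * + c) (trans (pos-+ d (b ℕ.* e)) (cong (_+_ (+ d)) (pos-* b e))) ⟩
    (+ d + + b * + e) - + b * + c     ≡⟨ factor-difference (+ d) (+ b) (+ e) (+ c) ⟩
    + d + + b * (+ e - + c)           ∎
    where
    open ≡-Reasoning
    add-sub : ∀ x y → x ≡ (x + y) - y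
    add-sub = solve-∀
    factor-difference : ∀ x y u v → (x + y * u) - y * v ≡ x + y * (u - v)
    factor-difference = solve-∀

  module RankCountsℤ {q : ℕ} (F : FiniteField q) {m : ℕ} where

    open RankRecurrence F {m}

    ρ-empty : + R F 0 m 0 ≡ 1ℤ
    ρ-empty = cong +_ R-empty

    ρ-above : ∀ n r → n < r → + R F n m r ≡ 0ℤ
    ρ-above n r n<r = cong +_ (R-above n r n<r)

    ρ-suc-zero : ∀ n → + R F (suc n) m 0 ≡ + R F n m 0
    ρ-suc-zero n = cong +_ (R-suc-zero n)

    ρ-suc-suc : ∀ n s →
      + R F (suc n) m (suc s) ≡ + R F n m (suc s) * (+ q) ^ suc s + + R F n m s * ((+ q) ^ m - (+ q) ^ s)
    ρ-suc-suc n s = trans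
      (move-to-difference {b = R F n m s} {c = q ℕ.^ s} {d = R F n m (suc s) ℕ.* q ℕ.^ suc s} {e = q ℕ.^ m}
                          (R-suc-suc n s))
      (cong₂ (λ y z → y + + R F n m s * z)
             (trans (pos-* (R F n m (suc s)) (q ℕ.^ suc s)) (cong (+ R F n m (suc s) *_) (pos-^ q (suc s))))
             (cong₂ _-_ (pos-^ q m) (pos-^ q s)))

open PochhammerSums

open import Data.Nat using (ℕ; _+_; _∸_; _*_; _≥_)
open import Data.Integer using (ℤ; +_) renaming (_*_ to _*ℤ_; _^_ to _^ℤ_)

lemma2p5 : (q : ℕ) (F : FiniteField q) (n m a : ℕ) → a ≥ n + m →
    sumTo a (λ r → + R F n m r *ℤ poch (+ q) (+ q) (a ∸ r)) *ℤ poch (+ q) (+ q) (a ∸ n ∸ m)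
      ≡ (+ q) ^ℤ (n * m) *ℤ poch (+ q) (+ q) (a ∸ n) *ℤ poch (+ q) (+ q) (a ∸ m)
lemma2p5 q F n m a a≥n+m = Φ-closed n a a≥n+m
  where
  open RankCountsℤ F {m}
  open RankSum (+ q) m (λ n r → + R F n m r) ρ-empty ρ-above ρ-suc-zero ρ-suc-suc
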